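{- Let $\lambda=(\lambda_1\ge\cdots\ge\lambda_\ell>0)$ be a partition of length $\ell$ and Frobenius rank $k$. Let $c_1<c_2<\cdots<c_k$ be the elements of $\{1,\ldots,\ell\}\setminus\{s-\lambda_s : k<s\le\ell\}$, and set $a_{i,j}=\lambda_i-i+c_j$ for $1\le i,j\le k$ (so $(h_{a_{i,j}})_{i,j=1}^k$ is the submatrix of the Jacobi–Trudi matrix $(h_{\lambda_i-i+j})_{i,j=1}^{\ell}$ obtained by deleting every row and column containing an entry $h_0=1$). Define $\sigma_i=a_{1,k}-a_{1,i}-k+i$ and $\mu_i=a_{i,i}+\sigma_i$ for $1\le i\le k$. Then the skew diagram $\mu/\sigma=\{(i,j):1\le i\le k,\ \sigma_i<j\le\mu_i\}$ contains a $k\times k$ square, i.e. there is an integer $c$ such that $(i,c+j)\in\mu/\sigma$ for all $1\le i,j\le k$.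
   Context: The Frobenius rank of $\lambda$ is the largest $i$ with $\lambda_i\ge i$. $h_m$ denotes the complete homogeneous symmetric function, with $h_m=0$ for $m<0$ and $h_0=1$. -}

module Defs where

open import Data.Nat using (ℕ; zero; suc; _≤_; _<_)
open import Data.Vec using (Vec; []; _∷_)
open import Data.Integer as ℤ using (ℤ; +_)
open import Data.Product using (_×_; ∃-syntax)
open import Relation.Binary.PropositionalEquality using (_≡_)
open import Relation.Nullary using (¬_)

-- 1-indexed lookup: at v i = v_i for 1 ≤ i ≤ n, and 0 otherwise.
at : ∀ {n} → Vec ℕ n → ℕ → ℕ
at [] _ = 0
at (x ∷ xs) zero = 0
at (x ∷ xs) (suc zero) = x
at (x ∷ xs) (suc (suc i)) = at xs (suc i)

IsPartition : ∀ {ℓ} → Vec ℕ ℓ → Set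
IsPartition {ℓ} lam =
  (∀ i → 1 ≤ i → i < ℓ → at lam (suc i) ≤ at lam i) ×
  (∀ i → 1 ≤ i → i ≤ ℓ → 0 < at lam i)

-- k is the Frobenius rank: the largest i (with 1 ≤ i ≤ ℓ) such that λ_i ≥ i
-- (k = 0 if there is no such i).
IsFrobeniusRank : ∀ {ℓ} → Vec ℕ ℓ → ℕ → Set
IsFrobeniusRank {ℓ} lam k =
  k ≤ ℓ ×
  (1 ≤ k → k ≤ at lam k) ×
  (∀ i → k < i → i ≤ ℓ → at lam i < i)

-- x ∈ {1,…,ℓ} \ {s - λ_s : k < s ≤ ℓ}   (x = s - λ_s written as x + λ_s = s,
-- an equation of integers stated in ℕ)
InCSet : ∀ {ℓ} → Vec ℕ ℓ → ℕ → ℕ → Set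
InCSet {ℓ} lam k x =
  1 ≤ x × x ≤ ℓ ×
  ¬ (∃[ s ] (k < s × s ≤ ℓ × x Data.Nat.+ at lam s ≡ s))

EnumeratesCSet : ∀ {ℓ} → Vec ℕ ℓ → ℕ → (ℕ → ℕ) → Set
EnumeratesCSet lam k c =
  (∀ i j → 1 ≤ i → i < j → j ≤ k → c i < c j) ×
  (∀ j → 1 ≤ j → j ≤ k → InCSet lam k (c j)) ×
  (∀ x → InCSet lam k x → ∃[ j ] (1 ≤ j × j ≤ k × c j ≡ x))

aEntry : ∀ {ℓ} → Vec ℕ ℓ → (ℕ → ℕ) → ℕ → ℕ → ℤ
aEntry lam c i j = (+ at lam i ℤ.- + i) ℤ.+ + c j

σ : ∀ {ℓ} → Vec ℕ ℓ → ℕ → (ℕ → ℕ) → ℕ → ℤ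
σ lam k c i = ((aEntry lam c 1 k ℤ.- aEntry lam c 1 i) ℤ.- + k) ℤ.+ + i

μ : ∀ {ℓ} → Vec ℕ ℓ → ℕ → (ℕ → ℕ) → ℕ → ℤ
μ lam k c i = aEntry lam c i i ℤ.+ σ lam k c i

InSkew : ∀ {ℓ} → Vec ℕ ℓ → ℕ → (ℕ → ℕ) → ℕ → ℤ → Set
InSkew lam k c i j = 1 ≤ i × i ≤ k × σ lam k c i ℤ.< j × j ℤ.≤ μ lam k c i

-- Both boundaries of μ/σ are translates of simple sequences: σ_i = (c_k - k) - (c_i - i)
-- and μ_i = (c_k - k) + λ_i. Since c is strictly increasing with c_1 ≥ 1 we have
-- c_i ≥ i, and since λ is weakly decreasing with λ_k ≥ k we have λ_i ≥ k for i ≤ k.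
-- Hence the columns c_k - k + 1, …, c_k - k + k lie in every row 1, …, k of μ/σ.
module Submission where

open import Defs
open import Data.Nat using (ℕ; _≤_)
open import Data.Vec using (Vec)
open import Data.Integer using (ℤ; +_; _+_)
open import Data.Product using (∃-syntax)

open import Data.Nat using (zero; suc; _<_; _≤′_; ≤′-refl; ≤′-step; s≤s; z≤n)
open import Data.Nat.Properties using (≤-refl; ≤-trans; <⇒≤; ≤⇒≤′; ≤′⇒≤)
open import Data.Integer using (_-_; +<+; +≤+) renaming (_<_ to _<ℤ_; _≤_ to _≤ℤ_)
open import Data.Integer.Properties
  using (+-monoʳ-<; +-monoʳ-≤; ≤-<-trans; i≤j⇒i-j≤0)
open import Data.Integer.Tactic.RingSolver using (solve-∀)
open import Data.Product using (_,_; proj₁; proj₂)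
open import Relation.Binary.PropositionalEquality using (_≡_; subst; sym)

at-antitone : ∀ {ℓ} (lam : Vec ℕ ℓ) → IsPartition lam →
  ∀ {i j} → 1 ≤ i → i ≤′ j → j ≤ ℓ → at lam j ≤ at lam i
at-antitone lam P 1≤i ≤′-refl        j≤ℓ = ≤-refl
at-antitone lam P 1≤i (≤′-step i≤′j) j≤ℓ =
  ≤-trans (proj₁ P _ (≤-trans 1≤i (≤′⇒≤ i≤′j)) j≤ℓ) (at-antitone lam P 1≤i i≤′j (<⇒≤ j≤ℓ))

increasing-positive⇒i≤f[i] : ∀ {k} {f : ℕ → ℕ} →
  (∀ i j → 1 ≤ i → i < j → j ≤ k → f i < f j) →
  (∀ j → 1 ≤ j → j ≤ k → 1 ≤ f j) →
  ∀ i → 1 ≤ i → i ≤ k → i ≤ f i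
increasing-positive⇒i≤f[i] inc pos (suc zero)    _ 1≤k = pos 1 ≤-refl 1≤k
increasing-positive⇒i≤f[i] inc pos (suc (suc i)) _ i+2≤k =
  ≤-trans (s≤s (increasing-positive⇒i≤f[i] inc pos (suc i) (s≤s z≤n) (<⇒≤ i+2≤k)))
          (inc (suc i) (suc (suc i)) (s≤s z≤n) ≤-refl i+2≤k)

module _ {ℓ} (lam : Vec ℕ ℓ) (k : ℕ) (c : ℕ → ℕ) where

  shift : ℤ
  shift = + c k - + k

  σ≡shift+i-c[i] : ∀ i → σ lam k c i ≡ shift + (+ i - + c i)
  σ≡shift+i-c[i] i = identity (+ at lam 1) (+ c k) (+ k) (+ i) (+ c i)
    where
    identity : ∀ l ck k i ci →
      (((l - + 1) + ck) - ((l - + 1) + ci) - k) + i ≡ (ck - k) + (i - ci)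
    identity = solve-∀

  μ≡shift+λ : ∀ i → μ lam k c i ≡ shift + + at lam i
  μ≡shift+λ i = identity (+ at lam 1) (+ at lam i) (+ c k) (+ k) (+ i) (+ c i)
    where
    identity : ∀ l li ck k i ci →
      ((li - i) + ci) + ((((l - + 1) + ck) - ((l - + 1) + ci) - k) + i) ≡ (ck - k) + li
    identity = solve-∀

  σ<shift+j : ∀ i j → i ≤ c i → 1 ≤ j → σ lam k c i <ℤ shift + + j
  σ<shift+j i j i≤c[i] 1≤j = subst (_<ℤ shift + + j) (sym (σ≡shift+i-c[i] i))
    (+-monoʳ-< shift (≤-<-trans (i≤j⇒i-j≤0 (+≤+ i≤c[i])) (+<+ 1≤j)))

  shift+j≤μ : ∀ i j → j ≤ at lam i → shift + + j ≤ℤ μ lam k c i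
  shift+j≤μ i j j≤λ = subst (shift + + j ≤ℤ_) (sym (μ≡shift+λ i)) (+-monoʳ-≤ shift (+≤+ j≤λ))

lemma3p2 : (ℓ : ℕ) (lam : Vec ℕ ℓ) (k : ℕ) (c : ℕ → ℕ) →
    IsPartition lam → IsFrobeniusRank lam k → EnumeratesCSet lam k c →
    ∃[ d ] (∀ i j → 1 ≤ i → i ≤ k → 1 ≤ j → j ≤ k → InSkew lam k c i (d + + j))
lemma3p2 ℓ lam k c P (k≤ℓ , k≤λ[k] , _) (inc , inCSet , _) = shift lam k c , square
  where
  i≤c[i] : ∀ i → 1 ≤ i → i ≤ k → i ≤ c i
  i≤c[i] = increasing-positive⇒i≤f[i] inc (λ j 1≤j j≤k → proj₁ (inCSet j 1≤j j≤k))

  k≤λ[i] : ∀ i → 1 ≤ i → i ≤ k → k ≤ at lam i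
  k≤λ[i] i 1≤i i≤k = ≤-trans (k≤λ[k] (≤-trans 1≤i i≤k)) (at-antitone lam P 1≤i (≤⇒≤′ i≤k) k≤ℓ)

  square : ∀ i j → 1 ≤ i → i ≤ k → 1 ≤ j → j ≤ k → InSkew lam k c i (shift lam k c + + j)
  square i j 1≤i i≤k 1≤j j≤k =
    1≤i , i≤k ,
    σ<shift+j lam k c i j (i≤c[i] i 1≤i i≤k) 1≤j ,
    shift+j≤μ lam k c i j (≤-trans j≤k (k≤λ[i] i 1≤i i≤k))
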